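{- Let $k\geq 3$ and let $G$ be a $k$-regular graph. Then the vertex set of the graph $\mathcal{J}_k$ constructed from $G$ can be partitioned into $k+1$ independent dominating sets of $\mathcal{J}_k$.
   Context: Given a $k$-regular graph $G$, the graph $\mathcal{J}_k$ is defined as follows. Its vertex set is $\{v_e : v\in V(G),\ e\in E(G) \text{ incident with } v\}\cup\{e_{v,u,i} : e=vu\in E(G),\ i\in[k-1]\}$ (for each edge $e=vu$ there are $k-1$ vertices $e_{v,u,1},\dots,e_{v,u,k-1}$). Its edge set is $\{v_ev_{e'} : v\in V(G),\ e\neq e' \text{ both incident with } v\}\cup\{e_{v,u,i}e_{v,u,i'} : i\neq i'\}\cup\{v_e e_{v,u,i} : i\in[k-1],\ e=vu \text{ incident with } v\}$; thus for each edge $e=vu$, the vertices $e_{v,u,1},\dots,e_{v,u,k-1}$ form a clique and each is adjacent to both $v_e$ and $u_e$, and for each vertex $v$ the vertices $v_e$ ($e\ni v$) form a clique. A set $S$ of vertices of a graph $H$ is an independent dominating set if no two vertices of $S$ are adjacent and every vertex of $H$ not in $S$ has a neighbor in $S$. Here $[m]=\{1,\dots,m\}$. -}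

module Defs where

open import Data.Nat using (ℕ; suc; _∸_)
open import Data.Fin using (Fin; _<_)
open import Data.Bool using (Bool; true; false)
open import Data.Product using (Σ; ∃; _×_)
open import Data.Sum using (_⊎_)
open import Data.Empty using (⊥)
open import Relation.Binary.PropositionalEquality using (_≡_; _≢_)
open import Function.Bundles using (_↔_)

-- A finite simple graph on vertex set Fin n, adjacency given as a Bool-valued
-- symmetric irreflexive relation (so "adj u v ≡ true" is proof-irrelevant).
record SimpleGraph : Set where
  field
    n      : ℕ
    adj    : Fin n → Fin n → Bool
    sym    : ∀ u v → adj u v ≡ adj v u
    irrefl : ∀ v → adj v v ≡ false

open SimpleGraph public

Regular : ℕ → SimpleGraph → Set
Regular k G = ∀ v → Σ (Fin (n G)) (λ u → adj G v u ≡ true) ↔ Fin k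

-- Vertices of 𝒥_k built from G.
--   end v u p     represents  v_e  for the edge e = vu (incidence of v with e)
--   mid v u q p i represents  e_{v,u,i} for the edge e = vu, stored with v < u
--                 (canonical representative of the unordered edge), i ∈ [k-1]
data JVertex (k : ℕ) (G : SimpleGraph) : Set where
  end : (v u : Fin (n G)) → adj G v u ≡ true → JVertex k G
  mid : (v u : Fin (n G)) → v < u → adj G v u ≡ true → Fin (k ∸ 1) → JVertex k G

JAdj : (k : ℕ) (G : SimpleGraph) → JVertex k G → JVertex k G → Set
JAdj k G (end v u _) (end v' u' _) = v ≡ v' × u ≢ u'
JAdj k G (mid a b _ _ i) (mid a' b' _ _ i') = a ≡ a' × b ≡ b' × i ≢ i'
JAdj k G (end v u _) (mid a b _ _ i) = (v ≡ a × u ≡ b) ⊎ (v ≡ b × u ≡ a)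
JAdj k G (mid a b _ _ i) (end v u _) = (v ≡ a × u ≡ b) ⊎ (v ≡ b × u ≡ a)

IsIndependentDominating : {V : Set} → (V → V → Set) → (V → Set) → Set
IsIndependentDominating {V} E S =
  (∀ x y → S x → S y → E x y → ⊥) ×
  (∀ x → (S x → ⊥) → ∃ λ y → E x y × S y)

-- Give the vertex v_e a colour in [k] so that at every vertex v the k vertices v_e get all k
-- colours and the two ends v_e, u_e of every edge get different colours, and give e_{v,u,1..k-1}
-- the k - 1 colours of [k + 1] missing at v_e and u_e. Every colour class is independent, and it
-- dominates: a vertex v_e whose colour is not t sees t at another v_{e'} when t is the colour of
-- u_e (which occurs at v), and at a middle vertex of e otherwise. Such end colourings exist for
-- k ≥ 2: a clash of colour a on an edge vu is removed by exchanging a with another colour b along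
-- the Kempe chain from v that alternately leaves by b and arrives on a; the exchange creates no
-- new clash, so the number of clashes strictly decreases.

module Submission where

open import Defs hiding (sym)
open import Data.Nat using (ℕ; zero; suc; _+_; _≤_; _<_; _≥_; _≤′_; ≤′-refl; ≤′-step; z≤n; s≤s)
open import Data.Nat.Properties using (+-mono-≤; +-mono-<-≤; +-mono-≤-<; ≤⇒≤′; ≤-pred; <-≤-trans; n<1+n)
open import Data.Bool using (true)
import Data.Bool.Properties as Bool
open import Data.Fin using (Fin; zero; suc; toℕ; fromℕ<; inject₁; punchIn; punchOut; _≟_)
open import Data.Fin.Properties
  using (any?; injective⇒≤; toℕ≤pred[n]; toℕ-injective; toℕ-fromℕ<; punchInᵢ≢i; punchIn-injective;
         punchIn-punchOut; inject₁-injective; <-cmp)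
open import Data.Fin.Permutation
  using (Permutation′; _⟨$⟩ʳ_; _⟨$⟩ˡ_; inverseˡ; inverseʳ; id; transpose; _∘ₚ_)
import Data.Fin.Permutation.Components as PC
open import Data.Maybe using (Maybe; just; nothing; _>>=_)
open import Data.Maybe.Properties using (just-injective) renaming (≡-dec to ≡-decMaybe)
open import Data.Product using (∃; ∃-syntax; _×_; _,_; proj₁; proj₂)
open import Data.Sum using (_⊎_; inj₁; inj₂)
open import Data.Empty using (⊥-elim)
open import Axiom.UniquenessOfIdentityProofs using (module Decidable⇒UIP)
open import Function.Bundles using (Inverse; Injection)
open import Function.Properties.Inverse using (↔⇒↣)
open import Relation.Nullary using (¬_; Dec; yes; no)
open import Relation.Nullary.Decidable using (map′; dec-true; dec-false)
open import Relation.Binary using (tri<; tri≈; tri>)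
open import Relation.Binary.PropositionalEquality
  using (_≡_; _≢_; refl; sym; trans; cong; cong₂; subst; module ≡-Reasoning)

transpose-matchˡ : ∀ {k} (a b : Fin k) → PC.transpose a b a ≡ b
transpose-matchˡ a b rewrite dec-true (a ≟ a) refl = refl

transpose-matchʳ : ∀ {k} (a b : Fin k) → PC.transpose a b b ≡ a
transpose-matchʳ a b with b ≟ a
... | yes b≡a = b≡a
... | no b≢a rewrite dec-true (b ≟ b) refl = refl

transpose-fixed : ∀ {k} {a b x : Fin k} → x ≢ a → x ≢ b → PC.transpose a b x ≡ x
transpose-fixed {a = a} {b} {x} x≢a x≢b rewrite dec-false (x ≟ a) x≢a | dec-false (x ≟ b) x≢b = refl

sum : ∀ {n} → (Fin n → ℕ) → ℕ
sum {zero}  f = 0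
sum {suc n} f = f zero + sum (λ i → f (suc i))

sum-mono-≤ : ∀ {n} {f g : Fin n → ℕ} → (∀ i → f i ≤ g i) → sum f ≤ sum g
sum-mono-≤ {zero}  f≤g = z≤n
sum-mono-≤ {suc n} f≤g = +-mono-≤ (f≤g zero) (sum-mono-≤ (λ i → f≤g (suc i)))

sum-mono-< : ∀ {n} {f g : Fin n → ℕ} → (∀ i → f i ≤ g i) → ∀ i → f i < g i → sum f < sum g
sum-mono-< f≤g zero    f<g = +-mono-<-≤ f<g (sum-mono-≤ (λ i → f≤g (suc i)))
sum-mono-< f≤g (suc i) f<g = +-mono-≤-< (f≤g zero) (sum-mono-< (λ i → f≤g (suc i)) i f<g)

indicator : ∀ {P : Set} → Dec P → ℕ
indicator (yes _) = 1
indicator (no _)  = 0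

indicator-mono-≤ : ∀ {P Q : Set} (P? : Dec P) (Q? : Dec Q) → (P → Q) → indicator P? ≤ indicator Q?
indicator-mono-≤ (yes _) (yes _) _   = s≤s z≤n
indicator-mono-≤ (yes p) (no ¬q) p⇒q = ⊥-elim (¬q (p⇒q p))
indicator-mono-≤ (no _)  _       _   = z≤n

indicator-mono-< : ∀ {P Q : Set} (P? : Dec P) (Q? : Dec Q) → ¬ P → Q → indicator P? < indicator Q?
indicator-mono-< (yes p) _       ¬p _ = ⊥-elim (¬p p)
indicator-mono-< (no _)  (yes _) _  _ = s≤s z≤n
indicator-mono-< (no _)  (no ¬q) _  q = ⊥-elim (¬q q)

module Chain {n : ℕ} (next : Fin n → Maybe (Fin n))
  (next-injective : ∀ {w₁ w₂ x} → next w₁ ≡ just x → next w₂ ≡ just x → w₁ ≡ w₂)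
  (s : Fin n) (s-unreached : ∀ {w} → next w ≢ just s) where

  iterate : ℕ → Maybe (Fin n)
  iterate zero    = just s
  iterate (suc m) = iterate m >>= next

  iterate-suc⁻ : ∀ m {x} → iterate (suc m) ≡ just x → ∃[ w ] iterate m ≡ just w × next w ≡ just x
  iterate-suc⁻ m e with iterate m
  ... | just w = w , refl , e

  iterate-suc⁺ : ∀ m {w x} → iterate m ≡ just w → next w ≡ just x → iterate (suc m) ≡ just x
  iterate-suc⁺ m e step rewrite e = step

  iterate-injective : ∀ i j {x} → iterate i ≡ just x → iterate j ≡ just x → i ≡ j
  iterate-injective zero    zero    _    _  = refl
  iterate-injective zero    (suc j) refl eʲ = ⊥-elim (s-unreached (proj₂ (proj₂ (iterate-suc⁻ j eʲ))))
  iterate-injective (suc i) zero    eⁱ refl = ⊥-elim (s-unreached (proj₂ (proj₂ (iterate-suc⁻ i eⁱ))))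
  iterate-injective (suc i) (suc j) eⁱ eʲ
    with iterate-suc⁻ i eⁱ | iterate-suc⁻ j eʲ
  ... | w , eⁱ′ , stepⁱ | _ , eʲ′ , stepʲ with next-injective stepⁱ stepʲ
  ... | refl = cong suc (iterate-injective i j eⁱ′ eʲ′)

  iterate-prefix : ∀ {i j x} → i ≤′ j → iterate j ≡ just x → ∃[ y ] iterate i ≡ just y
  iterate-prefix ≤′-refl         e = _ , e
  iterate-prefix (≤′-step {j} i≤j) e = iterate-prefix i≤j (proj₁ (proj₂ (iterate-suc⁻ j e)))

  -- The chain visits distinct vertices, so it is shorter than n.
  iterate-bounded : ∀ m {x} → iterate m ≡ just x → m < n
  iterate-bounded m e = injective⇒≤ {f = visited} visited-injective
    where
    visited-at : (i : Fin (suc m)) → ∃[ y ] iterate (toℕ i) ≡ just y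
    visited-at i = iterate-prefix (≤⇒≤′ (toℕ≤pred[n] i)) e
    visited : Fin (suc m) → Fin n
    visited i = proj₁ (visited-at i)
    visited-injective : ∀ {i j} → visited i ≡ visited j → i ≡ j
    visited-injective {i} {j} eq = toℕ-injective (iterate-injective (toℕ i) (toℕ j)
      (proj₂ (visited-at i)) (trans (proj₂ (visited-at j)) (cong just (sym eq))))

  OnChain : Fin n → Set
  OnChain x = ∃[ m ] iterate m ≡ just x

  onChain? : ∀ x → Dec (OnChain x)
  onChain? x = map′ (λ (i , e) → toℕ i , e) bounded
                     (any? (λ i → ≡-decMaybe _≟_ (iterate (toℕ i)) (just x)))
    where
    bounded : OnChain x → ∃[ i ] iterate (toℕ i) ≡ just x
    bounded (m , e) = fromℕ< m<n , subst (λ m′ → iterate m′ ≡ just x) (sym (toℕ-fromℕ< m<n)) e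
      where m<n = iterate-bounded m e

  start-onChain : OnChain s
  start-onChain = 0 , refl

  onChain-next : ∀ {w x} → OnChain w → next w ≡ just x → OnChain x
  onChain-next (m , e) step = suc m , iterate-suc⁺ m e step

  onChain-prev : ∀ {w z} → OnChain w → next z ≡ just w → OnChain z
  onChain-prev (zero  , refl) step = ⊥-elim (s-unreached step)
  onChain-prev (suc m , e)    step with iterate-suc⁻ m e
  ... | _ , e′ , step′ with next-injective step′ step
  ... | refl = m , e′

  onChain⇒start⊎reached : ∀ {x} → OnChain x → x ≡ s ⊎ ∃[ w ] next w ≡ just x
  onChain⇒start⊎reached (zero  , e) = inj₁ (sym (just-injective e))
  onChain⇒start⊎reached (suc m , e) = inj₂ (_ , proj₂ (proj₂ (iterate-suc⁻ m e)))

⟨$⟩ʳ-injective : ∀ {k} (π : Permutation′ k) {i j} → π ⟨$⟩ʳ i ≡ π ⟨$⟩ʳ j → i ≡ j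
⟨$⟩ʳ-injective π = Injection.injective (↔⇒↣ π)

-- A loopless k-regular multigraph on Fin n, presented by its ports: port j of v is one end of an
-- edge whose other end is port (backPort v j) of (neighbour v j).
record PortGraph (n k : ℕ) : Set where
  field
    neighbour          : Fin n → Fin k → Fin n
    backPort           : Fin n → Fin k → Fin k
    neighbour-backPort : ∀ v j → neighbour (neighbour v j) (backPort v j) ≡ v
    backPort-backPort  : ∀ v j → backPort (neighbour v j) (backPort v j) ≡ j
    loopless           : ∀ v j → neighbour v j ≢ v

PortColouring : ℕ → ℕ → Set
PortColouring n k = Fin n → Permutation′ k

module _ {n k : ℕ} (P : PortGraph n k) where
  open PortGraph P

  Clash : PortColouring n k → Fin n → Fin k → Set
  Clash π v j = π v ⟨$⟩ʳ j ≡ π (neighbour v j) ⟨$⟩ʳ backPort v j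

  clash? : ∀ π v j → Dec (Clash π v j)
  clash? π v j = π v ⟨$⟩ʳ j ≟ π (neighbour v j) ⟨$⟩ʳ backPort v j

  Proper : PortColouring n k → Set
  Proper π = ∀ v j → ¬ Clash π v j

  clashes : PortColouring n k → ℕ
  clashes π = sum λ v → sum λ j → indicator (clash? π v j)

  arrive-back : ∀ (π : PortColouring n k) v j →
    π (neighbour (neighbour v j) (backPort v j)) ⟨$⟩ʳ backPort (neighbour v j) (backPort v j) ≡ π v ⟨$⟩ʳ j
  arrive-back π v j = cong₂ (λ w i → π w ⟨$⟩ʳ i) (neighbour-backPort v j) (backPort-backPort v j)

  clash-flip : ∀ {π v j} → Clash π v j → Clash π (neighbour v j) (backPort v j)
  clash-flip {π} {v} {j} c = trans (sym c) (sym (arrive-back π v j))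

  clash-unflip : ∀ {π v j} → Clash π (neighbour v j) (backPort v j) → Clash π v j
  clash-unflip {π} {v} {j} c = trans (sym (arrive-back π v j)) (sym c)

  module KempeSwap (π : PortColouring n k) (v : Fin n) (j₀ : Fin k) (clash : Clash π v j₀)
                   (b : Fin k) (b≢a : b ≢ π v ⟨$⟩ʳ j₀) where
    a : Fin k
    a = π v ⟨$⟩ʳ j₀

    u : Fin n
    u = neighbour v j₀

    i₀ : Fin k
    i₀ = backPort v j₀

    bPort : Fin n → Fin k
    bPort w = π w ⟨$⟩ˡ b

    bPort-unique : ∀ {w j} → π w ⟨$⟩ʳ j ≡ b → bPort w ≡ j
    bPort-unique {w} e = trans (cong (π w ⟨$⟩ˡ_) (sym e)) (inverseˡ (π w))

    next : Fin n → Maybe (Fin n)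
    next w with π (neighbour w (bPort w)) ⟨$⟩ʳ backPort w (bPort w) ≟ a
    ... | yes _ = just (neighbour w (bPort w))
    ... | no _  = nothing

    next⁻ : ∀ {w x} → next w ≡ just x →
      x ≡ neighbour w (bPort w) × π x ⟨$⟩ʳ backPort w (bPort w) ≡ a
    next⁻ {w} e with π (neighbour w (bPort w)) ⟨$⟩ʳ backPort w (bPort w) ≟ a
    next⁻ refl | yes arrive-a = refl , arrive-a

    next⁺ : ∀ {w j} → π w ⟨$⟩ʳ j ≡ b → π (neighbour w j) ⟨$⟩ʳ backPort w j ≡ a →
      next w ≡ just (neighbour w j)
    next⁺ {w} {j} leave-b arrive-a with π (neighbour w (bPort w)) ⟨$⟩ʳ backPort w (bPort w) ≟ a
    ... | yes _ = cong (λ p → just (neighbour w p)) (bPort-unique leave-b)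
    ... | no ¬arrive-a = ⊥-elim (¬arrive-a
      (subst (λ p → π (neighbour w p) ⟨$⟩ʳ backPort w p ≡ a) (sym (bPort-unique leave-b)) arrive-a))

    arrival : ∀ {w x j} → next w ≡ just x → π x ⟨$⟩ʳ j ≡ a →
      neighbour x j ≡ w × backPort x j ≡ bPort w
    arrival {w} {x} {j} e x-a with next⁻ e
    ... | refl , arrive-a with ⟨$⟩ʳ-injective (π x) (trans x-a (sym arrive-a))
    ... | refl = neighbour-backPort w (bPort w) , backPort-backPort w (bPort w)

    next-injective : ∀ {w₁ w₂ x} → next w₁ ≡ just x → next w₂ ≡ just x → w₁ ≡ w₂
    next-injective {x = x} e₁ e₂ =
      trans (sym (proj₁ (arrival e₁ (inverseʳ (π x))))) (proj₁ (arrival e₂ (inverseʳ (π x))))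

    v-unreached : ∀ {w} → next w ≢ just v
    v-unreached {w} e with arrival e refl
    ... | refl , v-back-port = b≢a (begin
      b                  ≡⟨ inverseʳ (π w) ⟨
      π w ⟨$⟩ʳ bPort w   ≡⟨ cong (π w ⟨$⟩ʳ_) v-back-port ⟨
      π w ⟨$⟩ʳ i₀        ≡⟨ clash ⟨
      a                  ∎)
      where open ≡-Reasoning

    u-unreached : ∀ {w} → next w ≢ just u
    u-unreached {w} e with arrival e (sym clash)
    ... | u-back , u-back-port = b≢a (begin
      b                                      ≡⟨ inverseʳ (π w) ⟨
      π w ⟨$⟩ʳ bPort w                       ≡⟨ cong (π w ⟨$⟩ʳ_) u-back-port ⟨
      π w ⟨$⟩ʳ backPort u i₀                 ≡⟨ cong (λ x → π x ⟨$⟩ʳ backPort u i₀) u-back ⟨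
      π (neighbour u i₀) ⟨$⟩ʳ backPort u i₀  ≡⟨ arrive-back π v j₀ ⟩
      a                                      ∎)
      where open ≡-Reasoning

    open Chain next next-injective v v-unreached public

    u-offChain : ¬ OnChain u
    u-offChain on with onChain⇒start⊎reached on
    ... | inj₁ u≡v      = loopless v j₀ u≡v
    ... | inj₂ (_ , e)  = u-unreached e

    swapped : PortColouring n k
    swapped w with onChain? w
    ... | yes _ = π w ∘ₚ transpose a b
    ... | no _  = π w

    swapped-on : ∀ {w j} → OnChain w → swapped w ⟨$⟩ʳ j ≡ PC.transpose a b (π w ⟨$⟩ʳ j)
    swapped-on {w} on with onChain? w
    ... | yes _  = refl
    ... | no off = ⊥-elim (off on)

    swapped-off : ∀ {w j} → ¬ OnChain w → swapped w ⟨$⟩ʳ j ≡ π w ⟨$⟩ʳ j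
    swapped-off {w} off with onChain? w
    ... | yes on = ⊥-elim (off on)
    ... | no _   = refl

    -- An edge leaving the chain never carries a or b at its chain end, so the swap cannot
    -- create a clash on it.
    clash-leaving : ∀ {w j} → OnChain w → ¬ OnChain (neighbour w j) →
      Clash swapped w j → Clash π w j
    clash-leaving {w} {j} on off c = by-colour (π w ⟨$⟩ʳ j ≟ a) (π w ⟨$⟩ʳ j ≟ b)
      where
      swapped-clash : PC.transpose a b (π w ⟨$⟩ʳ j) ≡ π (neighbour w j) ⟨$⟩ʳ backPort w j
      swapped-clash = trans (sym (swapped-on on)) (trans c (swapped-off off))
      by-colour : Dec (π w ⟨$⟩ʳ j ≡ a) → Dec (π w ⟨$⟩ʳ j ≡ b) → Clash π w j
      by-colour (yes w-a) _ = ⊥-elim (off (onChain-prev on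
        (subst (λ y → next (neighbour w j) ≡ just y) (neighbour-backPort w j)
          (next⁺ x-b (trans (arrive-back π w j) w-a)))))
        where
        x-b : π (neighbour w j) ⟨$⟩ʳ backPort w j ≡ b
        x-b = trans (sym swapped-clash) (trans (cong (PC.transpose a b) w-a) (transpose-matchˡ a b))
      by-colour (no _) (yes w-b) = ⊥-elim (off (onChain-next on (next⁺ w-b x-a)))
        where
        x-a : π (neighbour w j) ⟨$⟩ʳ backPort w j ≡ a
        x-a = trans (sym swapped-clash) (trans (cong (PC.transpose a b) w-b) (transpose-matchʳ a b))
      by-colour (no w≢a) (no w≢b) = trans (sym (transpose-fixed w≢a w≢b)) swapped-clash

    clash-swapped⇒clash : ∀ w j → Clash swapped w j → Clash π w j
    clash-swapped⇒clash w j c = by-membership (onChain? w) (onChain? (neighbour w j))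
      where
      by-membership : Dec (OnChain w) → Dec (OnChain (neighbour w j)) → Clash π w j
      by-membership (yes on) (yes on′) =
        ⟨$⟩ʳ-injective (transpose a b) (trans (sym (swapped-on on)) (trans c (swapped-on on′)))
      by-membership (no off) (no off′) = trans (sym (swapped-off off)) (trans c (swapped-off off′))
      by-membership (yes on) (no off′) = clash-leaving on off′ c
      by-membership (no off) (yes on′) =
        clash-unflip {π} {w} (clash-leaving on′ off″ (clash-flip {swapped} {w} c))
        where
        off″ : ¬ OnChain (neighbour (neighbour w j) (backPort w j))
        off″ rewrite neighbour-backPort w j = off

    resolved : ¬ Clash swapped v j₀
    resolved c = b≢a (trans (sym (transpose-matchˡ a b))
      (trans (sym (swapped-on start-onChain)) (trans c (trans (swapped-off u-offChain) (sym clash)))))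

    fewer-clashes : clashes swapped < clashes π
    fewer-clashes =
      sum-mono-< (λ w → sum-mono-≤ λ j → at w j) v
        (sum-mono-< (at v) j₀ (indicator-mono-< (clash? swapped v j₀) (clash? π v j₀) resolved clash))
      where
      at : ∀ w j → indicator (clash? swapped w j) ≤ indicator (clash? π w j)
      at w j = indicator-mono-≤ (clash? swapped w j) (clash? π w j) (clash-swapped⇒clash w j)

proper-colouring-exists : ∀ {n k} (P : PortGraph n (suc (suc k))) → ∃ (Proper P)
proper-colouring-exists {n} {k} P = resolve (suc (clashes P identity)) identity (n<1+n _)
  where
  identity : PortColouring n (suc (suc k))
  identity _ = id

  improve : ∀ π v j → Clash P π v j → ∃[ π′ ] clashes P π′ < clashes P π
  improve π v j c = swapped , fewer-clashes
    where open KempeSwap P π v j c (punchIn (π v ⟨$⟩ʳ j) zero) (punchInᵢ≢i (π v ⟨$⟩ʳ j) zero)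

  resolve : ∀ m π → clashes P π < m → ∃ (Proper P)
  resolve (suc m) π bound with any? (λ v → any? (λ j → clash? P π v j))
  ... | no none = π , λ v j c → none (v , j , c)
  ... | yes (v , j , c) with improve π v j c
  ...   | π′ , fewer = resolve m π′ (<-≤-trans fewer (≤-pred bound))

-- The colours of Fin (2 + m) other than x and y, enumerated in order.
avoid₂ : ∀ {m} (x y : Fin (suc (suc m))) → x ≢ y → Fin m → Fin (suc (suc m))
avoid₂ x y x≢y i = punchIn x (punchIn (punchOut x≢y) i)

module _ {m : ℕ} {x y : Fin (suc (suc m))} (x≢y : x ≢ y) where

  avoid₂-≢ˡ : ∀ i → avoid₂ x y x≢y i ≢ x
  avoid₂-≢ˡ i = punchInᵢ≢i x _

  avoid₂-≢ʳ : ∀ i → avoid₂ x y x≢y i ≢ y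
  avoid₂-≢ʳ i e = punchInᵢ≢i (punchOut x≢y) i
    (punchIn-injective x _ _ (trans e (sym (punchIn-punchOut x≢y))))

  avoid₂-injective : ∀ {i j} → avoid₂ x y x≢y i ≡ avoid₂ x y x≢y j → i ≡ j
  avoid₂-injective e = punchIn-injective (punchOut x≢y) _ _ (punchIn-injective x _ _ e)

  avoid₂-surjective : ∀ t → t ≢ x → t ≢ y → ∃[ i ] avoid₂ x y x≢y i ≡ t
  avoid₂-surjective t t≢x t≢y =
    punchOut y′≢t′ , trans (cong (punchIn x) (punchIn-punchOut y′≢t′)) (punchIn-punchOut x≢t)
    where
    x≢t : x ≢ t
    x≢t e = t≢x (sym e)
    y′≢t′ : punchOut x≢y ≢ punchOut x≢t
    y′≢t′ e = t≢y (trans (sym (punchIn-punchOut x≢t))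
                (trans (cong (punchIn x) (sym e)) (punchIn-punchOut x≢y)))

module _ (G : SimpleGraph) where

  adj-irrelevant : ∀ {v u} (p q : adj G v u ≡ true) → p ≡ q
  adj-irrelevant = Decidable⇒UIP.≡-irrelevant Bool._≟_

  adj-flip : ∀ {v u} → adj G v u ≡ true → adj G u v ≡ true
  adj-flip {v} {u} p = trans (SimpleGraph.sym G u v) p

  module Ports {k : ℕ} (reg : Regular k G) where

    port : ∀ v u → adj G v u ≡ true → Fin k
    port v u p = Inverse.to (reg v) (u , p)

    neighbour : Fin (n G) → Fin k → Fin (n G)
    neighbour v j = proj₁ (Inverse.from (reg v) j)

    adjacent : ∀ v j → adj G v (neighbour v j) ≡ true
    adjacent v j = proj₂ (Inverse.from (reg v) j)

    port-cong : ∀ {v v′ u u′} (p : adj G v u ≡ true) (p′ : adj G v′ u′ ≡ true) →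
      v ≡ v′ → u ≡ u′ → port v u p ≡ port v′ u′ p′
    port-cong p p′ refl refl = cong (port _ _) (adj-irrelevant p p′)

    neighbour-port : ∀ v u p → neighbour v (port v u p) ≡ u
    neighbour-port v u p = cong proj₁ (Inverse.strictlyInverseʳ (reg v) (u , p))

    port-neighbour : ∀ v j → port v (neighbour v j) (adjacent v j) ≡ j
    port-neighbour v j = Inverse.strictlyInverseˡ (reg v) j

    backPort : Fin (n G) → Fin k → Fin k
    backPort v j = port (neighbour v j) v (adj-flip (adjacent v j))

    backPort-port : ∀ v u p → backPort v (port v u p) ≡ port u v (adj-flip p)
    backPort-port v u p = port-cong _ _ (neighbour-port v u p) refl

    portGraph : PortGraph (n G) k
    portGraph = record
      { neighbour          = neighbour
      ; backPort           = backPort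
      ; neighbour-backPort = λ v j → neighbour-port (neighbour v j) v _
      ; backPort-backPort  = λ v j →
          trans (port-cong _ (adjacent v j) (neighbour-port (neighbour v j) v _) refl) (port-neighbour v j)
      ; loopless           = loopless
      }
      where
      loopless : ∀ v j → neighbour v j ≢ v
      loopless v j e with trans (sym (subst (λ u → adj G v u ≡ true) e (adjacent v j)))
                                (SimpleGraph.irrefl G v)
      ... | ()

module JColouring (G : SimpleGraph) {k : ℕ} (reg : Regular (suc k) G)
                  (π : PortColouring (n G) (suc k)) (proper : Proper (Ports.portGraph G reg) π) where
  open Ports G reg

  endColour : ∀ v u → adj G v u ≡ true → Fin (suc (suc k))
  endColour v u p = inject₁ (π v ⟨$⟩ʳ port v u p)

  endColour-distinct : ∀ v u p → endColour v u p ≢ endColour u v (adj-flip G p)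
  endColour-distinct v u p e = proper v (port v u p) (trans (inject₁-injective e)
    (sym (cong₂ (λ w i → π w ⟨$⟩ʳ i) (neighbour-port v u p) (backPort-port v u p))))

  colour : JVertex (suc k) G → Fin (suc (suc k))
  colour (end v u p)     = endColour v u p
  colour (mid v u _ p i) =
    avoid₂ (endColour v u p) (endColour u v (adj-flip G p)) (endColour-distinct v u p) i

  endColour-onto : ∀ v c → ∃[ j ] endColour v (neighbour v j) (adjacent v j) ≡ inject₁ c
  endColour-onto v c = π v ⟨$⟩ˡ c ,
    cong inject₁ (trans (cong (π v ⟨$⟩ʳ_) (port-neighbour v (π v ⟨$⟩ˡ c))) (inverseʳ (π v)))

  mid-≢-end : ∀ v u q a b l p i → JAdj (suc k) G (end v u q) (mid a b l p i) →
    colour (mid a b l p i) ≢ colour (end v u q)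
  mid-≢-end v u q .v .u _ p i (inj₁ (refl , refl)) with adj-irrelevant G q p
  ... | refl = avoid₂-≢ˡ (endColour-distinct v u p) i
  mid-≢-end v u q .u .v _ p i (inj₂ (refl , refl)) with adj-irrelevant G q (adj-flip G p)
  ... | refl = avoid₂-≢ʳ (endColour-distinct u v p) i

  adjacent⇒colour-≢ : ∀ x y → JAdj (suc k) G x y → colour x ≢ colour y
  adjacent⇒colour-≢ (end v u p) (end .v u′ p′) (refl , u≢u′) e = u≢u′ (begin
    u                          ≡⟨ neighbour-port v u p ⟨
    neighbour v (port v u p)   ≡⟨ cong (neighbour v) (⟨$⟩ʳ-injective (π v) (inject₁-injective e)) ⟩
    neighbour v (port v u′ p′) ≡⟨ neighbour-port v u′ p′ ⟩
    u′                         ∎)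
    where open ≡-Reasoning
  adjacent⇒colour-≢ (mid a b _ p i) (mid .a .b _ p′ i′) (refl , refl , i≢i′) e
    with adj-irrelevant G p p′
  ... | refl = i≢i′ (avoid₂-injective (endColour-distinct a b p) e)
  adjacent⇒colour-≢ (end v u q) (mid a b l p i) x~y e = mid-≢-end v u q a b l p i x~y (sym e)
  adjacent⇒colour-≢ (mid a b l p i) (end v u q) x~y e = mid-≢-end v u q a b l p i x~y e

  dominate-through-edge : ∀ t v u p → t ≢ endColour v u p → t ≢ endColour u v (adj-flip G p) →
    ∃[ y ] JAdj (suc k) G (end v u p) y × colour y ≡ t
  dominate-through-edge t v u p t≢v t≢u with <-cmp v u
  ... | tri< v<u _ _ with avoid₂-surjective (endColour-distinct v u p) t t≢v t≢u
  ...   | i , e = mid v u v<u p i , inj₁ (refl , refl) , e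
  dominate-through-edge t v u p t≢v t≢u | tri≈ _ refl _
    with trans (sym p) (SimpleGraph.irrefl G v)
  ... | ()
  dominate-through-edge t v u p t≢v t≢u | tri> _ _ u<v
    with avoid₂-surjective (endColour-distinct u v (adj-flip G p)) t t≢u
           (subst (λ q → t ≢ endColour v u q) (adj-irrelevant G p _) t≢v)
  ... | i , e = mid u v u<v (adj-flip G p) i , inj₂ (refl , refl) , e

  dominate-end : ∀ t v u p → endColour v u p ≢ t → ∃[ y ] JAdj (suc k) G (end v u p) y × colour y ≡ t
  dominate-end t v u p v≢t with t ≟ endColour u v (adj-flip G p)
  ... | no t≢u = dominate-through-edge t v u p (λ e → v≢t (sym e)) t≢u
  ... | yes t≡u with endColour-onto v (π u ⟨$⟩ʳ port u v (adj-flip G p))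
  ...   | j , e = end v (neighbour v j) (adjacent v j) , (refl , u≢u′) , trans e (sym t≡u)
    where
    u≢u′ : u ≢ neighbour v j
    u≢u′ u≡u′ = v≢t (trans (cong inject₁ (cong (π v ⟨$⟩ʳ_) (port-cong p (adjacent v j) refl u≡u′)))
                      (trans e (sym t≡u)))

  dominate-mid : ∀ t a b l p i → colour (mid a b l p i) ≢ t →
    ∃[ y ] JAdj (suc k) G (mid a b l p i) y × colour y ≡ t
  dominate-mid t a b l p i x≢t with t ≟ endColour a b p | t ≟ endColour b a (adj-flip G p)
  ... | yes t≡a | _       = end a b p , inj₁ (refl , refl) , sym t≡a
  ... | no _    | yes t≡b = end b a (adj-flip G p) , inj₂ (refl , refl) , sym t≡b
  ... | no t≢a  | no t≢b with avoid₂-surjective (endColour-distinct a b p) t t≢a t≢b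
  ...   | j , e = mid a b l p j , (refl , refl , λ i≡j → x≢t (trans (cong (avoid₂ _ _ _) i≡j) e)) , e

  colour-class-independent-dominating : ∀ t → IsIndependentDominating (JAdj (suc k) G) (λ x → colour x ≡ t)
  colour-class-independent-dominating t =
    (λ x y x-t y-t x~y → adjacent⇒colour-≢ x y x~y (trans x-t (sym y-t))) , dominate
    where
    dominate : ∀ x → colour x ≢ t → ∃[ y ] JAdj (suc k) G x y × colour y ≡ t
    dominate (end v u p)     = dominate-end t v u p
    dominate (mid a b l p i) = dominate-mid t a b l p i

theorem2 : (k : ℕ) → k ≥ 3 → (G : SimpleGraph) → Regular k G →
    ∃ λ (c : JVertex k G → Fin (suc k)) →
      ∀ (i : Fin (suc k)) → IsIndependentDominating (JAdj k G) (λ x → c x ≡ i)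
theorem2 (suc (suc (suc k))) (s≤s (s≤s (s≤s z≤n))) G reg
  with proper-colouring-exists (Ports.portGraph G reg)
... | π , proper = colour , colour-class-independent-dominating
  where open JColouring G reg π proper
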